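{- Let $L_i,L_j$ be non-commutative formulas over a field $\mathbb{F}$ in the variables $x_1,\ldots,x_n$ such that $L_i$ is obtained from $L_j$ by a single application of the commutativity rule for multiplication (i.e., replacing one occurrence of a subformula $(G\cdot H)$ by $(H\cdot G)$). Then there is a non-commutative formula $\Phi(\overline x,\overline y)$ in the variables $\{x_\ell:\ell\in[n]\}\cup\{y_{\alpha,\beta}:\alpha<\beta\in[n]\}$ such that (1) $\Phi(\overline x,\overline 0)=0$; (2) $\Phi(\overline x,(C_{\alpha,\beta})_{\alpha<\beta})=L_i-L_j$; and (3) $|\Phi|\le|L_i|^2|L_j|^2$.
   Context: A non-commutative formula is a rooted tree of fan-in at most two with leaves labeled by variables or field elements and internal $+$/$\times$ gates, children of $\times$ gates ordered; it computes an element of the free algebra $\mathbb{F}\langle\overline x,\overline y\rangle$, and $|\Phi|$ is its number of nodes. $C_{\alpha,\beta}$ denotes the commutator $x_\alpha x_\beta-x_\beta x_\alpha$. The equalities in (1) and (2) are identities of non-commutative polynomials, with $y_{\alpha,\beta}$ substituted by $0$, resp. by $C_{\alpha,\beta}$. -}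

module Defs where

open import Level using (Level; _⊔_; suc)
open import Algebra.Bundles using (CommutativeRing)
open import Data.Nat as ℕ using (ℕ)
open import Data.Fin as Fin using (Fin; _<_)
open import Data.Fin.Properties as FinP using ()
open import Data.List using (List; []; _∷_)
open import Data.Product using (Σ; ∃; _×_; _,_)
open import Relation.Nullary using (¬_; Dec; yes; no)
open import Relation.Binary.Definitions using (DecidableEquality)
open import Relation.Binary.PropositionalEquality using (_≡_; refl; cong)

record Field (c ℓ : Level) : Set (Level.suc (c ⊔ ℓ)) where
  field
    commutativeRing : CommutativeRing c ℓ
  open CommutativeRing commutativeRing public
  field
    1≉0     : ¬ (1# ≈ 0#)
    inverse : ∀ a → ¬ (a ≈ 0#) → Σ Carrier (λ b → a * b ≈ 1#)

-- Variables: x_ℓ (ℓ ∈ [n]) and y_{α,β} (α < β ∈ [n]).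
-- The proof α < β is irrelevant, so y_{α,β} is determined by α, β.

data XVar (n : ℕ) : Set where
  x : Fin n → XVar n

data XYVar (n : ℕ) : Set where
  x : Fin n → XYVar n
  y : (α β : Fin n) → .(α < β) → XYVar n

_≟X_ : ∀ {n} → DecidableEquality (XVar n)
x i ≟X x j with i Fin.≟ j
... | yes refl = yes refl
... | no ¬p = no λ { refl → ¬p refl }

_≟XY_ : ∀ {n} → DecidableEquality (XYVar n)
x i ≟XY x j with i Fin.≟ j
... | yes refl = yes refl
... | no ¬p = no λ { refl → ¬p refl }
x _ ≟XY y _ _ _ = no λ ()
y _ _ _ ≟XY x _ = no λ ()
y a b _ ≟XY y c d _ with a Fin.≟ c | b Fin.≟ d
... | yes refl | yes refl = yes refl
... | no ¬p | _ = no λ { refl → ¬p refl }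
... | yes _ | no ¬q = no λ { refl → ¬q refl }

module _ {c ℓ} (F : Field c ℓ) where
  open Field F

  infixl 6 _⊕_
  infixl 7 _⊗_

  data Formula (V : Set) : Set c where
    var   : V → Formula V
    const : Carrier → Formula V
    _⊕_   : Formula V → Formula V → Formula V
    _⊗_   : Formula V → Formula V → Formula V

  size : ∀ {V} → Formula V → ℕ
  size (var _)   = 1
  size (const _) = 1
  size (f ⊕ g)   = ℕ.suc (size f ℕ.+ size g)
  size (f ⊗ g)   = ℕ.suc (size f ℕ.+ size g)

  data CommStep {V : Set} : Formula V → Formula V → Set c where
    here : ∀ G H → CommStep (G ⊗ H) (H ⊗ G)
    ⊕ˡ   : ∀ {f f'} g → CommStep f f' → CommStep (f ⊕ g) (f' ⊕ g)
    ⊕ʳ   : ∀ f {g g'} → CommStep g g' → CommStep (f ⊕ g) (f ⊕ g')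
    ⊗ˡ   : ∀ {f f'} g → CommStep f f' → CommStep (f ⊗ g) (f' ⊗ g)
    ⊗ʳ   : ∀ f {g g'} → CommStep g g' → CommStep (f ⊗ g) (f ⊗ g')

  subst : ∀ {V W} → (V → Formula W) → Formula V → Formula W
  subst σ (var v)   = σ v
  subst σ (const a) = const a
  subst σ (f ⊕ g)   = subst σ f ⊕ subst σ g
  subst σ (f ⊗ g)   = subst σ f ⊗ subst σ g

  -- The non-commutative polynomial computed by a formula, as its
  -- coefficient function on words (monomials) over V: an element of the
  -- free algebra F⟨V⟩ is determined by its coefficients.

  -- sum over all splittings w = u ++ v of  p u * q v
  convolve : ∀ {V : Set} → (List V → Carrier) → (List V → Carrier) → List V → Carrier
  convolve p q []       = p [] * q []
  convolve p q (a ∷ w)  = p [] * q (a ∷ w) + convolve (λ u → p (a ∷ u)) q w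

  coeff : ∀ {V} → DecidableEquality V → Formula V → List V → Carrier
  coeff _≟_ (var v) (u ∷ []) with v ≟ u
  ... | yes _ = 1#
  ... | no _  = 0#
  coeff _≟_ (var v) _ = 0#
  coeff _≟_ (const a) [] = a
  coeff _≟_ (const a) (_ ∷ _) = 0#
  coeff _≟_ (f ⊕ g) w = coeff _≟_ f w + coeff _≟_ g w
  coeff _≟_ (f ⊗ g) w = convolve (coeff _≟_ f) (coeff _≟_ g) w

  σ₀ : ∀ {n} → XYVar n → Formula (XVar n)
  σ₀ (x i)     = var (x i)
  σ₀ (y _ _ _) = const 0#

  Comm : ∀ {n} → Fin n → Fin n → Formula (XVar n)
  Comm α β = var (x α) ⊗ var (x β) ⊕ const (- 1#) ⊗ (var (x β) ⊗ var (x α))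

  σC : ∀ {n} → XYVar n → Formula (XVar n)
  σC (x i)     = var (x i)
  σC (y α β _) = Comm α β

module Submission where

-- L_i - L_j is the commutator [H, G] placed in the context of the step.
-- The commutator of two formulas is expanded by the Leibniz rules
-- [ab, c] = a[b, c] + [a, c]b and [a, bc] = b[a, c] + [a, b]c down to commutators
-- of variables [x_a, x_b], which become the leaves ±y_{a,b} (or 0 for a = b).
-- Every ȳ-leaf then sits in a summand, so ȳ ↦ 0 kills Φ, while ȳ ↦ C̄ yields the
-- commutator.  A size count gives |[G, H]| ≤ 2|G||H|(|G|+|H|), hence
-- |Φ| ≤ |L_j|³ ≤ |L_i|²|L_j|² (a commutation step preserves size).

open import Defs
open import Data.Nat using (ℕ; _≤_; _*_; _^_)
open import Data.List using (List; []; _∷_)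
open import Data.Product using (Σ; _×_; _,_)
open import Algebra.Bundles using (Ring)
open import Relation.Binary.Definitions using (DecidableEquality)
open import Relation.Binary.PropositionalEquality as ≡ using (_≡_)
import Algebra.Construct.Pointwise as Pointwise
import Algebra.Properties.Ring as RingProperties
import Algebra.Properties.AbelianGroup as AbelianGroupProperties
import Algebra.Properties.CommutativeSemigroup as CommutativeSemigroupProperties
import Relation.Binary.Reasoning.Setoid as SetoidReasoning
import Data.Nat.Properties

-- Each inequality u ≤ v is proved from an
-- identity v = u + r with an explicit excess r, checked by the ring solver (which
-- needs powers written out as products).
module SizeArithmetic where
  open import Data.Nat using (suc; _+_; s≤s)
  open import Data.Nat.Properties using (≤-trans; m≤m+n; m≤m*n; +-mono-≤; +-monoˡ-≤; +-monoʳ-≤)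
  open import Data.Nat.Tactic.RingSolver using (solve-∀)

  ≤-by-excess : ∀ {u v} r → v ≡ u + r → u ≤ v
  ≤-by-excess {u} r v≡u+r = ≡.subst (u ≤_) (≡.sym v≡u+r) (m≤m+n u r)

  -- The size bound for the commutator formula of two formulas of sizes s, t.
  bracketBound : ℕ → ℕ → ℕ
  bracketBound s t = 2 * (s * t * (s + t))

  bracketBound-comm : ∀ s t → bracketBound s t ≡ bracketBound t s
  bracketBound-comm = identity
    where
    identity : ∀ s t → 2 * (s * t * (s + t)) ≡ 2 * (t * s * (t + s))
    identity = solve-∀

  -- The commutator formula with a constant, a single node, fits the bound.
  bracketBound-pos : ∀ s t → 1 ≤ s → 1 ≤ t → 1 ≤ bracketBound s t
  bracketBound-pos (suc a) (suc b) _ _ =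
    ≤-by-excess (3 + 4 * a + 4 * b + 4 * (a * b) + 2 * ((a + b) * (1 + a + b + a * b))) (identity a b)
    where
    identity : ∀ a b → 2 * (suc a * suc b * (suc a + suc b))
             ≡ 1 + (3 + 4 * a + 4 * b + 4 * (a * b) + 2 * ((a + b) * (1 + a + b + a * b)))
    identity = solve-∀

  -- The size of the commutator formula of a product G₁G₂ (or H₁H₂) against a
  -- formula of size T, given bounds u, v for the two recursive commutators.
  bracketBound-product : ∀ a b {T u v} → 1 ≤ T →
    u ≤ bracketBound a T → v ≤ bracketBound b T →
    suc (suc (a + v) + suc (u + b)) ≤ bracketBound (suc (a + b)) T
  bracketBound-product a b {suc t} _ u≤ v≤ =
    ≤-trans (s≤s (+-mono-≤ (s≤s (+-monoʳ-≤ a v≤)) (s≤s (+-monoˡ-≤ b u≤))))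
      (≤-by-excess (1 + 6 * t + 2 * (t * t) + 3 * (a + b) + 4 * (t * (a + b)) + 4 * ((1 + t) * (a * b)))
        (identity a b t))
    where
    identity : ∀ a b t → 2 * (suc (a + b) * suc t * (suc (a + b) + suc t))
      ≡ suc (suc (a + 2 * (b * suc t * (b + suc t))) + suc (2 * (a * suc t * (a + suc t)) + b))
        + (1 + 6 * t + 2 * (t * t) + 3 * (a + b) + 4 * (t * (a + b)) + 4 * ((1 + t) * (a * b)))
    identity = solve-∀

  -- The size of the commutator formula of a sum, which is smaller than that of a product.
  bracketBound-sum : ∀ a b {T u v} → 1 ≤ T →
    u ≤ bracketBound a T → v ≤ bracketBound b T →
    suc (u + v) ≤ bracketBound (suc (a + b)) T
  bracketBound-sum a b {u = u} {v = v} T≥1 u≤ v≤ =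
    ≤-trans (≤-by-excess (2 + a + b) (identity a b u v)) (bracketBound-product a b T≥1 u≤ v≤)
    where
    identity : ∀ a b u v → suc (suc (a + v) + suc (u + b)) ≡ suc (u + v) + (2 + a + b)
    identity = solve-∀

  -- The commutator of the two factors of G·H is smaller than |G·H|³.
  bracketBound≤cube : ∀ s t → bracketBound s t ≤ suc (t + s) ^ 3
  bracketBound≤cube s t =
    ≤-by-excess (1 + 3 * (s + t) + 3 * ((s + t) * (s + t)) + s * (s * s) + t * (t * t) + t * (t * s) + t * (s * s))
      (identity s t)
    where
    identity : ∀ a b → suc (b + a) * (suc (b + a) * (suc (b + a) * 1)) ≡ 2 * (a * b * (a + b))
      + (1 + 3 * (a + b) + 3 * ((a + b) * (a + b)) + a * (a * a) + b * (b * b) + b * (b * a) + b * (a * a))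
    identity = solve-∀

  -- Multiplying the witness by an unchanged factor (of size b, resp. a) keeps the cube bound.
  cube-growˡ : ∀ a b → suc (a ^ 3 + b) ≤ suc (a + b) ^ 3
  cube-growˡ a b =
    ≤-by-excess (3 * a + 2 * b + 3 * ((a + b) * (a + b)) + 3 * (a * (a * b)) + 3 * (a * (b * b)) + b * (b * b))
      (identity a b)
    where
    identity : ∀ a b → suc (a + b) * (suc (a + b) * (suc (a + b) * 1)) ≡ suc (a * (a * (a * 1)) + b)
      + (3 * a + 2 * b + 3 * ((a + b) * (a + b)) + 3 * (a * (a * b)) + 3 * (a * (b * b)) + b * (b * b))
    identity = solve-∀

  cube-growʳ : ∀ a b → suc (a + b ^ 3) ≤ suc (a + b) ^ 3
  cube-growʳ a b =
    ≤-by-excess (3 * b + 2 * a + 3 * ((a + b) * (a + b)) + 3 * (b * (b * a)) + 3 * (b * (a * a)) + a * (a * a))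
      (identity a b)
    where
    identity : ∀ a b → suc (a + b) * (suc (a + b) * (suc (a + b) * 1)) ≡ suc (a + b * (b * (b * 1)))
      + (3 * b + 2 * a + 3 * ((a + b) * (a + b)) + 3 * (b * (b * a)) + 3 * (b * (a * a)) + a * (a * a))
    identity = solve-∀

  cube≤square² : ∀ {N} → 1 ≤ N → N ^ 3 ≤ N ^ 2 * N ^ 2
  cube≤square² {suc m} _ = ≡.subst (suc m ^ 3 ≤_) (identity m) (m≤m*n (suc m ^ 3) (suc m))
    where
    identity : ∀ m → suc m * (suc m * (suc m * 1)) * suc m ≡ suc m * (suc m * 1) * (suc m * (suc m * 1))
    identity = solve-∀

module CommutatorIdentities {r ℓ} (R : Ring r ℓ) where
  open Ring R renaming (_*_ to _·_)
  open RingProperties R using (x[y-z]≈xy-xz; [y-z]x≈yx-zx)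
  open AbelianGroupProperties +-abelianGroup using (⁻¹-anti-homo‿-; ⁻¹-∙-comm)
  open CommutativeSemigroupProperties +-commutativeSemigroup using (interchange)
  open SetoidReasoning setoid

  sub-interchange : ∀ a b c d → (a - b) + (c - d) ≈ (a + c) - (b + d)
  sub-interchange a b c d = trans (interchange a (- b) c (- d)) (+-congˡ (⁻¹-∙-comm b d))

  sub-telescope : ∀ a b c → (a - b) + (b - c) ≈ a - c
  sub-telescope a b c = begin
    (a - b) + (b - c)      ≈⟨ +-assoc a (- b) (b - c) ⟩
    a + (- b + (b - c))    ≈⟨ +-congˡ (+-assoc (- b) b (- c)) ⟨
    a + ((- b + b) - c)    ≈⟨ +-congˡ (+-congʳ (-‿inverseˡ b)) ⟩
    a + (0# - c)           ≈⟨ +-congˡ (+-identityˡ (- c)) ⟩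
    a - c                  ∎

  sub-cancelʳ : ∀ a b c → (a + c) - (b + c) ≈ a - b
  sub-cancelʳ a b c = begin
    (a + c) - (b + c)      ≈⟨ sub-interchange a b c c ⟨
    (a - b) + (c - c)      ≈⟨ +-congˡ (-‿inverseʳ c) ⟩
    (a - b) + 0#           ≈⟨ +-identityʳ (a - b) ⟩
    a - b                  ∎

  sub-cancelˡ : ∀ a b c → (c + a) - (c + b) ≈ a - b
  sub-cancelˡ a b c = begin
    (c + a) - (c + b)      ≈⟨ sub-interchange c c a b ⟨
    (c - c) + (a - b)      ≈⟨ +-congʳ (-‿inverseʳ c) ⟩
    0# + (a - b)           ≈⟨ +-identityˡ (a - b) ⟩
    a - b                  ∎

  +-vanish : ∀ {a b} → a ≈ 0# → b ≈ 0# → a + b ≈ 0#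
  +-vanish a≈0 b≈0 = trans (+-cong a≈0 b≈0) (+-identityˡ 0#)

  *-vanishˡ : ∀ {a} b → a ≈ 0# → a · b ≈ 0#
  *-vanishˡ b a≈0 = trans (*-congʳ a≈0) (zeroˡ b)

  *-vanishʳ : ∀ a {b} → b ≈ 0# → a · b ≈ 0#
  *-vanishʳ a b≈0 = trans (*-congˡ b≈0) (zeroʳ a)

  [_,_] : Carrier → Carrier → Carrier
  [ a , b ] = a · b - b · a

  [,]-commuting : ∀ {a b} → a · b ≈ b · a → [ a , b ] ≈ 0#
  [,]-commuting {a} {b} ab≈ba = trans (+-congˡ (-‿cong (sym ab≈ba))) (-‿inverseʳ (a · b))

  [,]-anticomm : ∀ a b → - [ b , a ] ≈ [ a , b ]
  [,]-anticomm a b = ⁻¹-anti-homo‿- (b · a) (a · b)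

  [,]-+ˡ : ∀ a b c → [ a + b , c ] ≈ [ a , c ] + [ b , c ]
  [,]-+ˡ a b c = begin
    (a + b) · c - c · (a + b)              ≈⟨ +-cong (distribʳ c a b) (-‿cong (distribˡ c a b)) ⟩
    (a · c + b · c) - (c · a + c · b)      ≈⟨ sub-interchange (a · c) (c · a) (b · c) (c · b) ⟨
    [ a , c ] + [ b , c ]                  ∎

  [,]-+ʳ : ∀ a b c → [ a , b + c ] ≈ [ a , b ] + [ a , c ]
  [,]-+ʳ a b c = begin
    a · (b + c) - (b + c) · a              ≈⟨ +-cong (distribˡ a b c) (-‿cong (distribʳ a b c)) ⟩
    (a · b + a · c) - (b · a + c · a)      ≈⟨ sub-interchange (a · b) (b · a) (a · c) (c · a) ⟨
    [ a , b ] + [ a , c ]                  ∎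

  [,]-*ˡ : ∀ a b c → [ a · b , c ] ≈ a · [ b , c ] + [ a , c ] · b
  [,]-*ˡ a b c = sym (begin
    a · [ b , c ] + [ a , c ] · b
      ≈⟨ +-cong (x[y-z]≈xy-xz a (b · c) (c · b)) ([y-z]x≈yx-zx b (a · c) (c · a)) ⟩
    (a · (b · c) - a · (c · b)) + (a · c · b - c · a · b)
      ≈⟨ +-cong (+-cong (*-assoc a b c) (-‿cong (*-assoc a c b))) (+-congˡ (-‿cong (sym (*-assoc c a b)))) ⟨
    (a · b · c - a · c · b) + (a · c · b - c · (a · b))
      ≈⟨ sub-telescope (a · b · c) (a · c · b) (c · (a · b)) ⟩
    [ a · b , c ] ∎)

  [,]-*ʳ : ∀ a b c → [ a , b · c ] ≈ b · [ a , c ] + [ a , b ] · c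
  [,]-*ʳ a b c = sym (begin
    b · [ a , c ] + [ a , b ] · c
      ≈⟨ +-comm (b · [ a , c ]) ([ a , b ] · c) ⟩
    [ a , b ] · c + b · [ a , c ]
      ≈⟨ +-cong ([y-z]x≈yx-zx c (a · b) (b · a)) (x[y-z]≈xy-xz b (a · c) (c · a)) ⟩
    (a · b · c - b · a · c) + (b · (a · c) - b · (c · a))
      ≈⟨ +-cong (+-cong (*-assoc a b c) (-‿cong (*-assoc b a c))) (+-congˡ (-‿cong (sym (*-assoc b c a)))) ⟩
    (a · (b · c) - b · (a · c)) + (b · (a · c) - b · c · a)
      ≈⟨ sub-telescope (a · (b · c)) (b · (a · c)) (b · c · a) ⟩
    [ a , b · c ] ∎)

module SeriesRing {c ℓ} (F : Field c ℓ) {V : Set} (_≟_ : DecidableEquality V) where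
  open Field F renaming (_*_ to _·_)
  open RingProperties ring using (-1*x≈-x)
  open CommutativeSemigroupProperties +-commutativeSemigroup using (interchange)
  open SetoidReasoning setoid

  Series : Set c
  Series = List V → Carrier

  infix 4 _≐_
  _≐_ : Series → Series → Set ℓ
  p ≐ q = ∀ w → p w ≈ q w

  infixl 7 _⋆_
  _⋆_ : Series → Series → Series
  _⋆_ = convolve F

  ⟦_⟧ : Formula F V → Series
  ⟦_⟧ = coeff F _≟_

  -- The derivative ∂ₐ p = p(a ∷ -), so that (p ⋆ q)(a ∷ w) = p[] q(a ∷ w) + (∂ₐ p ⋆ q)(w).
  ∂ : V → Series → Series
  ∂ a p u = p (a ∷ u)

  ⋆-cong : ∀ {p p' q q'} → p ≐ p' → q ≐ q' → p ⋆ q ≐ p' ⋆ q'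
  ⋆-cong p≐ q≐ []      = *-cong (p≐ []) (q≐ [])
  ⋆-cong p≐ q≐ (a ∷ w) = +-cong (*-cong (p≐ []) (q≐ (a ∷ w))) (⋆-cong (λ u → p≐ (a ∷ u)) q≐ w)

  ⋆-zeroˡ : ∀ q → (λ _ → 0#) ⋆ q ≐ λ _ → 0#
  ⋆-zeroˡ q []      = zeroˡ (q [])
  ⋆-zeroˡ q (a ∷ w) = trans (+-cong (zeroˡ (q (a ∷ w))) (⋆-zeroˡ q w)) (+-identityˡ 0#)

  ⋆-constˡ : ∀ k q → ⟦ const k ⟧ ⋆ q ≐ λ w → k · q w
  ⋆-constˡ k q []      = refl
  ⋆-constˡ k q (a ∷ w) = trans (+-congˡ (⋆-zeroˡ q w)) (+-identityʳ (k · q (a ∷ w)))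

  ⋆-constʳ : ∀ p k → p ⋆ ⟦ const k ⟧ ≐ λ w → p w · k
  ⋆-constʳ p k []      = refl
  ⋆-constʳ p k (a ∷ w) = trans (+-cong (zeroʳ (p [])) (⋆-constʳ (∂ a p) k w)) (+-identityˡ (p (a ∷ w) · k))

  ⋆-distribˡ : ∀ p q r → p ⋆ (λ w → q w + r w) ≐ λ w → (p ⋆ q) w + (p ⋆ r) w
  ⋆-distribˡ p q r []      = distribˡ (p []) (q []) (r [])
  ⋆-distribˡ p q r (a ∷ w) =
    trans (+-cong (distribˡ (p []) _ _) (⋆-distribˡ (∂ a p) q r w)) (interchange _ _ _ _)

  ⋆-distribʳ : ∀ r p q → (λ w → p w + q w) ⋆ r ≐ λ w → (p ⋆ r) w + (q ⋆ r) w
  ⋆-distribʳ r p q []      = distribʳ (r []) (p []) (q [])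
  ⋆-distribʳ r p q (a ∷ w) =
    trans (+-cong (distribʳ _ (p []) (q [])) (⋆-distribʳ r (∂ a p) (∂ a q) w)) (interchange _ _ _ _)

  ⋆-scaleˡ : ∀ k p q → (λ w → k · p w) ⋆ q ≐ λ w → k · (p ⋆ q) w
  ⋆-scaleˡ k p q []      = *-assoc k (p []) (q [])
  ⋆-scaleˡ k p q (a ∷ w) =
    trans (+-cong (*-assoc k (p []) _) (⋆-scaleˡ k (∂ a p) q w)) (sym (distribˡ k _ _))

  -- Associativity, by induction on the word: in ((p ⋆ q) ⋆ r)(a ∷ w) the first
  -- letter a is consumed by r, by q (after p's constant term) or by p.
  ⋆-assoc : ∀ p q r → (p ⋆ q) ⋆ r ≐ p ⋆ (q ⋆ r)
  ⋆-assoc p q r []      = *-assoc (p []) (q []) (r [])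
  ⋆-assoc p q r (a ∷ w) = begin
    p [] · q [] · r (a ∷ w) + ((λ u → p [] · ∂ a q u + (∂ a p ⋆ q) u) ⋆ r) w
      ≈⟨ +-congˡ (⋆-distribʳ r (λ u → p [] · ∂ a q u) (∂ a p ⋆ q) w) ⟩
    p [] · q [] · r (a ∷ w) + (((λ u → p [] · ∂ a q u) ⋆ r) w + ((∂ a p ⋆ q) ⋆ r) w)
      ≈⟨ +-cong (*-assoc _ _ _) (+-cong (⋆-scaleˡ (p []) (∂ a q) r w) (⋆-assoc (∂ a p) q r w)) ⟩
    p [] · (q [] · r (a ∷ w)) + (p [] · (∂ a q ⋆ r) w + (∂ a p ⋆ (q ⋆ r)) w)
      ≈⟨ +-assoc _ _ _ ⟨
    (p [] · (q [] · r (a ∷ w)) + p [] · (∂ a q ⋆ r) w) + (∂ a p ⋆ (q ⋆ r)) w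
      ≈⟨ +-congʳ (distribˡ _ _ _) ⟨
    p [] · (q [] · r (a ∷ w) + (∂ a q ⋆ r) w) + (∂ a p ⋆ (q ⋆ r)) w ∎

  seriesRing : Ring c ℓ
  seriesRing = record
    { Carrier = Series
    ; _≈_     = _≐_
    ; _+_     = λ p q w → p w + q w
    ; _*_     = _⋆_
    ; -_      = λ p w → - p w
    ; 0#      = λ _ → 0#
    ; 1#      = ⟦ const 1# ⟧
    ; isRing  = record
      { +-isAbelianGroup = Pointwise.isAbelianGroup (List V) +-isAbelianGroup
      ; *-cong           = ⋆-cong
      ; *-assoc          = ⋆-assoc
      ; *-identity       = (λ q w → trans (⋆-constˡ 1# q w) (*-identityˡ (q w)))
                         , (λ p w → trans (⋆-constʳ p 1# w) (*-identityʳ (p w)))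
      ; distrib          = ⋆-distribˡ , ⋆-distribʳ
      }
    }

  -- Constants are central since F is commutative.
  const-central : ∀ k p → ⟦ const k ⟧ ⋆ p ≐ p ⋆ ⟦ const k ⟧
  const-central k p w = trans (⋆-constˡ k p w) (trans (*-comm k (p w)) (sym (⋆-constʳ p k w)))

  const-neg-one : ∀ p → ⟦ const (- 1#) ⟧ ⋆ p ≐ λ w → - p w
  const-neg-one p w = trans (⋆-constˡ (- 1#) p w) (-1*x≈-x (p w))

  const-zero : ⟦ const 0# ⟧ ≐ λ _ → 0#
  const-zero []      = refl
  const-zero (_ ∷ _) = refl

module FormulaSize {c ℓ} (F : Field c ℓ) where
  open import Data.Nat using (suc; _+_; z≤n; s≤s)
  open import Data.Nat.Properties using (+-comm)

  size-pos : ∀ {V} (Φ : Formula F V) → 1 ≤ size F Φ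
  size-pos (var _)   = s≤s z≤n
  size-pos (const _) = s≤s z≤n
  size-pos (_ ⊕ _)   = s≤s z≤n
  size-pos (_ ⊗ _)   = s≤s z≤n

  CommStep-size : ∀ {V} {L L' : Formula F V} → CommStep F L L' → size F L' ≡ size F L
  CommStep-size (here G H) = ≡.cong suc (+-comm (size F H) (size F G))
  CommStep-size (⊕ˡ g s)   = ≡.cong (λ m → suc (m + size F g)) (CommStep-size s)
  CommStep-size (⊕ʳ f s)   = ≡.cong (λ m → suc (size F f + m)) (CommStep-size s)
  CommStep-size (⊗ˡ g s)   = ≡.cong (λ m → suc (m + size F g)) (CommStep-size s)
  CommStep-size (⊗ʳ f s)   = ≡.cong (λ m → suc (size F f + m)) (CommStep-size s)

module Construction {c ℓ} (F : Field c ℓ) (n : ℕ) where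
  open import Data.Nat using (suc; _+_; z≤n; s≤s)
  open import Data.Nat.Properties
    using (≤-refl; ≤-trans; ≤-reflexive; m≤m+n; m≤n+m; m≤n⇒m≤1+n; +-monoˡ-≤; +-monoʳ-≤; ^-monoˡ-≤)
  open import Data.Fin using (Fin; _<_)
  open import Data.Fin.Properties using (<-cmp)
  open import Relation.Binary.Definitions using (Tri; tri<; tri≈; tri>)
  open SizeArithmetic
  open FormulaSize F
  open SeriesRing F (_≟X_ {n})
  module 𝔽 = Field F
  open Ring seriesRing using (0#; -_; _-_; -‿cong; +-cong; refl; sym; trans; reflexive; setoid)
  open RingProperties seriesRing using (x[y-z]≈xy-xz; [y-z]x≈yx-zx)
  open CommutatorIdentities seriesRing
  open SetoidReasoning setoid

  X : Set
  X = XVar n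

  XY : Set
  XY = XYVar n

  ⟦_⟧C : Formula F XY → Series
  ⟦ Φ ⟧C = ⟦ subst F (σC F) Φ ⟧

  ⟦_⟧₀ : Formula F XY → Series
  ⟦ Φ ⟧₀ = ⟦ subst F (σ₀ F) Φ ⟧

  embed : Formula F X → Formula F XY
  embed = subst F (λ { (x i) → var (x i) })

  subst-embed : (σ : XY → Formula F X) → (∀ i → σ (x i) ≡ var (x i)) →
    ∀ G → subst F σ (embed G) ≡ G
  subst-embed σ σx (var (x i)) = σx i
  subst-embed σ σx (const k)   = ≡.refl
  subst-embed σ σx (f ⊕ g)     = ≡.cong₂ _⊕_ (subst-embed σ σx f) (subst-embed σ σx g)
  subst-embed σ σx (f ⊗ g)     = ≡.cong₂ _⊗_ (subst-embed σ σx f) (subst-embed σ σx g)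

  embed-C : ∀ G → ⟦ embed G ⟧C ≐ ⟦ G ⟧
  embed-C G = reflexive (≡.cong ⟦_⟧ (subst-embed (σC F) (λ _ → ≡.refl) G))

  size-embed : ∀ G → size F (embed G) ≡ size F G
  size-embed (var (x i)) = ≡.refl
  size-embed (const k)   = ≡.refl
  size-embed (f ⊕ g)     = ≡.cong₂ (λ a b → suc (a + b)) (size-embed f) (size-embed g)
  size-embed (f ⊗ g)     = ≡.cong₂ (λ a b → suc (a + b)) (size-embed f) (size-embed g)

  varBracket : (a b : Fin n) → Tri (a < b) (a ≡ b) (b < a) → Formula F XY
  varBracket a b (tri< a<b _ _) = var (y a b a<b)
  varBracket a b (tri≈ _ _ _)   = const 𝔽.0#
  varBracket a b (tri> _ _ b<a) = const (𝔽.- 𝔽.1#) ⊗ var (y b a b<a)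

  Comm-C : ∀ a b → ⟦ Comm F a b ⟧ ≐ [ ⟦ var (x a) ⟧ , ⟦ var (x b) ⟧ ]
  Comm-C a b w = 𝔽.+-congˡ (const-neg-one (⟦ var (x b) ⟧ ⋆ ⟦ var (x a) ⟧) w)

  varBracket-C : ∀ a b t → ⟦ varBracket a b t ⟧C ≐ [ ⟦ var (x a) ⟧ , ⟦ var (x b) ⟧ ]
  varBracket-C a b (tri< _ _ _)       = Comm-C a b
  varBracket-C a b (tri≈ _ ≡.refl _) = trans const-zero (sym ([,]-commuting refl))
  varBracket-C a b (tri> _ _ _)       = begin
    ⟦ const (𝔽.- 𝔽.1#) ⟧ ⋆ ⟦ Comm F b a ⟧  ≈⟨ const-neg-one ⟦ Comm F b a ⟧ ⟩
    - ⟦ Comm F b a ⟧                       ≈⟨ -‿cong (Comm-C b a) ⟩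
    - [ ⟦ var (x b) ⟧ , ⟦ var (x a) ⟧ ]    ≈⟨ [,]-anticomm ⟦ var (x a) ⟧ ⟦ var (x b) ⟧ ⟩
    [ ⟦ var (x a) ⟧ , ⟦ var (x b) ⟧ ]      ∎

  varBracket-0 : ∀ a b t → ⟦ varBracket a b t ⟧₀ ≐ 0#
  varBracket-0 a b (tri< _ _ _) = const-zero
  varBracket-0 a b (tri≈ _ _ _) = const-zero
  varBracket-0 a b (tri> _ _ _) = *-vanishʳ ⟦ const (𝔽.- 𝔽.1#) ⟧ const-zero

  varBracket-size : ∀ a b t → size F (varBracket a b t) ≤ bracketBound 1 1
  varBracket-size a b (tri< _ _ _) = s≤s z≤n
  varBracket-size a b (tri≈ _ _ _) = s≤s z≤n
  varBracket-size a b (tri> _ _ _) = s≤s (s≤s (s≤s z≤n))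

  bracketVar : X → Formula F X → Formula F XY
  bracketVar v (const _)     = const 𝔽.0#
  bracketVar v (H₁ ⊕ H₂)     = bracketVar v H₁ ⊕ bracketVar v H₂
  bracketVar v (H₁ ⊗ H₂)     = embed H₁ ⊗ bracketVar v H₂ ⊕ bracketVar v H₁ ⊗ embed H₂
  bracketVar (x a) (var (x b)) = varBracket a b (<-cmp a b)

  bracket : Formula F X → Formula F X → Formula F XY
  bracket (const _) H = const 𝔽.0#
  bracket (G₁ ⊕ G₂) H = bracket G₁ H ⊕ bracket G₂ H
  bracket (G₁ ⊗ G₂) H = embed G₁ ⊗ bracket G₂ H ⊕ bracket G₁ H ⊗ embed G₂
  bracket (var v)   H = bracketVar v H

  const-bracketˡ : ∀ k p → 0# ≐ [ ⟦ const k ⟧ , p ]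
  const-bracketˡ k p = sym ([,]-commuting (const-central k p))

  const-bracketʳ : ∀ p k → 0# ≐ [ p , ⟦ const k ⟧ ]
  const-bracketʳ p k = sym ([,]-commuting (sym (const-central k p)))

  -- Under ȳ ↦ C̄ the commutator formulas compute commutators (Leibniz rules at ⊗ nodes).
  bracketVar-C : ∀ v H → ⟦ bracketVar v H ⟧C ≐ [ ⟦ var v ⟧ , ⟦ H ⟧ ]
  bracketVar-C v (const k) = trans const-zero (const-bracketʳ ⟦ var v ⟧ k)
  bracketVar-C v (H₁ ⊕ H₂) =
    trans (+-cong (bracketVar-C v H₁) (bracketVar-C v H₂)) (sym ([,]-+ʳ ⟦ var v ⟧ ⟦ H₁ ⟧ ⟦ H₂ ⟧))
  bracketVar-C v (H₁ ⊗ H₂) =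
    trans (+-cong (⋆-cong (embed-C H₁) (bracketVar-C v H₂)) (⋆-cong (bracketVar-C v H₁) (embed-C H₂)))
      (sym ([,]-*ʳ ⟦ var v ⟧ ⟦ H₁ ⟧ ⟦ H₂ ⟧))
  bracketVar-C (x a) (var (x b)) = varBracket-C a b (<-cmp a b)

  bracket-C : ∀ G H → ⟦ bracket G H ⟧C ≐ [ ⟦ G ⟧ , ⟦ H ⟧ ]
  bracket-C (const k) H = trans const-zero (const-bracketˡ k ⟦ H ⟧)
  bracket-C (G₁ ⊕ G₂) H =
    trans (+-cong (bracket-C G₁ H) (bracket-C G₂ H)) (sym ([,]-+ˡ ⟦ G₁ ⟧ ⟦ G₂ ⟧ ⟦ H ⟧))
  bracket-C (G₁ ⊗ G₂) H =
    trans (+-cong (⋆-cong (embed-C G₁) (bracket-C G₂ H)) (⋆-cong (bracket-C G₁ H) (embed-C G₂)))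
      (sym ([,]-*ˡ ⟦ G₁ ⟧ ⟦ G₂ ⟧ ⟦ H ⟧))
  bracket-C (var v)   H = bracketVar-C v H

  -- Every ȳ-leaf of a commutator formula sits in a summand, so ȳ ↦ 0 kills it.
  bracketVar-0 : ∀ v H → ⟦ bracketVar v H ⟧₀ ≐ 0#
  bracketVar-0 v (const k) = const-zero
  bracketVar-0 v (H₁ ⊕ H₂) = +-vanish (bracketVar-0 v H₁) (bracketVar-0 v H₂)
  bracketVar-0 v (H₁ ⊗ H₂) = +-vanish (*-vanishʳ _ (bracketVar-0 v H₂)) (*-vanishˡ _ (bracketVar-0 v H₁))
  bracketVar-0 (x a) (var (x b)) = varBracket-0 a b (<-cmp a b)

  bracket-0 : ∀ G H → ⟦ bracket G H ⟧₀ ≐ 0#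
  bracket-0 (const k) H = const-zero
  bracket-0 (G₁ ⊕ G₂) H = +-vanish (bracket-0 G₁ H) (bracket-0 G₂ H)
  bracket-0 (G₁ ⊗ G₂) H = +-vanish (*-vanishʳ _ (bracket-0 G₂ H)) (*-vanishˡ _ (bracket-0 G₁ H))
  bracket-0 (var v)   H = bracketVar-0 v H

  -- |[G, H]| ≤ 2|G||H|(|G| + |H|), the [v, H] case being the one with |G| = 1.
  bracketVar-size : ∀ v H → size F (bracketVar v H) ≤ bracketBound (size F H) 1
  bracketVar-size v (const k) = bracketBound-pos 1 1 (s≤s z≤n) (s≤s z≤n)
  bracketVar-size v (H₁ ⊕ H₂) =
    bracketBound-sum (size F H₁) (size F H₂) ≤-refl (bracketVar-size v H₁) (bracketVar-size v H₂)
  bracketVar-size v (H₁ ⊗ H₂) rewrite size-embed H₁ | size-embed H₂ =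
    bracketBound-product (size F H₁) (size F H₂) ≤-refl (bracketVar-size v H₁) (bracketVar-size v H₂)
  bracketVar-size (x a) (var (x b)) = varBracket-size a b (<-cmp a b)

  bracket-size : ∀ G H → size F (bracket G H) ≤ bracketBound (size F G) (size F H)
  bracket-size (const k) H = bracketBound-pos 1 (size F H) (s≤s z≤n) (size-pos H)
  bracket-size (G₁ ⊕ G₂) H =
    bracketBound-sum (size F G₁) (size F G₂) (size-pos H) (bracket-size G₁ H) (bracket-size G₂ H)
  bracket-size (G₁ ⊗ G₂) H rewrite size-embed G₁ | size-embed G₂ =
    bracketBound-product (size F G₁) (size F G₂) (size-pos H) (bracket-size G₁ H) (bracket-size G₂ H)
  bracket-size (var v)   H =
    ≤-trans (bracketVar-size v H) (≤-reflexive (bracketBound-comm (size F H) 1))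

  -- The witness for one commutation step: the commutator at the rewritten
  -- position, multiplied by the unchanged factors around it.
  stepWitness : ∀ {L L' : Formula F X} → CommStep F L L' → Formula F XY
  stepWitness (here G H) = bracket H G
  stepWitness (⊕ˡ g s)   = stepWitness s
  stepWitness (⊕ʳ f s)   = stepWitness s
  stepWitness (⊗ˡ g s)   = stepWitness s ⊗ embed g
  stepWitness (⊗ʳ f s)   = embed f ⊗ stepWitness s

  -- Under ȳ ↦ C̄ the witness computes L' - L: the unchanged summands cancel and
  -- the unchanged factors distribute over the difference.
  stepWitness-C : ∀ {L L'} (s : CommStep F L L') → ⟦ stepWitness s ⟧C ≐ ⟦ L' ⟧ - ⟦ L ⟧
  stepWitness-C (here G H) = bracket-C H G
  stepWitness-C (⊕ˡ {f} {f'} g s) = trans (stepWitness-C s) (sym (sub-cancelʳ ⟦ f' ⟧ ⟦ f ⟧ ⟦ g ⟧))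
  stepWitness-C (⊕ʳ f {g} {g'} s) = trans (stepWitness-C s) (sym (sub-cancelˡ ⟦ g' ⟧ ⟦ g ⟧ ⟦ f ⟧))
  stepWitness-C (⊗ˡ {f} {f'} g s) =
    trans (⋆-cong (stepWitness-C s) (embed-C g)) ([y-z]x≈yx-zx ⟦ g ⟧ ⟦ f' ⟧ ⟦ f ⟧)
  stepWitness-C (⊗ʳ f {g} {g'} s) =
    trans (⋆-cong (embed-C f) (stepWitness-C s)) (x[y-z]≈xy-xz ⟦ f ⟧ ⟦ g' ⟧ ⟦ g ⟧)

  stepWitness-0 : ∀ {L L'} (s : CommStep F L L') → ⟦ stepWitness s ⟧₀ ≐ 0#
  stepWitness-0 (here G H) = bracket-0 H G
  stepWitness-0 (⊕ˡ g s)   = stepWitness-0 s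
  stepWitness-0 (⊕ʳ f s)   = stepWitness-0 s
  stepWitness-0 (⊗ˡ g s)   = *-vanishˡ _ (stepWitness-0 s)
  stepWitness-0 (⊗ʳ f s)   = *-vanishʳ _ (stepWitness-0 s)

  -- |witness| ≤ |L|³: the commutator bound at the rewritten position, then growth in the context.
  stepWitness-size : ∀ {L L'} (s : CommStep F L L') → size F (stepWitness s) ≤ size F L ^ 3
  stepWitness-size (here G H) = ≤-trans (bracket-size H G) (bracketBound≤cube (size F H) (size F G))
  stepWitness-size (⊕ˡ {f} g s) =
    ≤-trans (stepWitness-size s) (^-monoˡ-≤ 3 (m≤n⇒m≤1+n (m≤m+n (size F f) (size F g))))
  stepWitness-size (⊕ʳ f {g} s) =
    ≤-trans (stepWitness-size s) (^-monoˡ-≤ 3 (m≤n⇒m≤1+n (m≤n+m (size F g) (size F f))))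
  stepWitness-size (⊗ˡ {f} g s) rewrite size-embed g =
    ≤-trans (s≤s (+-monoˡ-≤ (size F g) (stepWitness-size s))) (cube-growˡ (size F f) (size F g))
  stepWitness-size (⊗ʳ f {g} s) rewrite size-embed f =
    ≤-trans (s≤s (+-monoʳ-≤ (size F f) (stepWitness-size s))) (cube-growʳ (size F f) (size F g))

lemma4p6 : ∀ {c ℓ} (F : Field c ℓ) (n : ℕ) (Li Lj : Formula F (XVar n)) →
    CommStep F Lj Li →
    Σ (Formula F (XYVar n)) (λ Φ →
      ((w : List (XVar n)) →
        Field._≈_ F (coeff F _≟X_ (subst F (σ₀ F) Φ) w) (Field.0# F))
      × ((w : List (XVar n)) →
        Field._≈_ F (coeff F _≟X_ (subst F (σC F) Φ) w)
          (Field._-_ F (coeff F _≟X_ Li w) (coeff F _≟X_ Lj w)))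
      × (size F Φ ≤ (size F Li ^ 2) * (size F Lj ^ 2)))
lemma4p6 F n Li Lj step =
  stepWitness step , stepWitness-0 step , stepWitness-C step , size-bound
  where
  open Construction F n using (stepWitness; stepWitness-0; stepWitness-C; stepWitness-size)
  open FormulaSize F using (size-pos; CommStep-size)
  open SizeArithmetic using (cube≤square²)
  open Data.Nat.Properties.≤-Reasoning

  size-bound : size F (stepWitness step) ≤ (size F Li ^ 2) * (size F Lj ^ 2)
  size-bound = begin
    size F (stepWitness step)       ≤⟨ stepWitness-size step ⟩
    size F Lj ^ 3                   ≤⟨ cube≤square² (size-pos Lj) ⟩
    size F Lj ^ 2 * size F Lj ^ 2   ≡⟨ ≡.cong (λ m → m ^ 2 * size F Lj ^ 2) (CommStep-size step) ⟨
    size F Li ^ 2 * size F Lj ^ 2   ∎
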